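{- (1) Let $\mathbf{X}$ and $\mathbf{Y}$ be represented spaces. A multivalued function $f:\subseteq\mathbf{X}\rightrightarrows\mathbf{Y}$ is computable (continuous) as a function between represented spaces if and only if it is computable (continuous) as a function between $\mathbb{T}^\omega$-represented spaces. (2) Let $\mathbf{X}=(X,\psi_X)$ and $\mathbf{Y}=(Y,\psi_Y)$ be $\mathbb{T}^\omega$-represented spaces and let $\overline{\mathbf{X}}=(X,\psi_X\circ\delta_{\mathbb{T}^\omega})$ and $\overline{\mathbf{Y}}=(Y,\psi_Y\circ\delta_{\mathbb{T}^\omega})$ be the induced represented spaces. Then $f:\subseteq\mathbf{X}\rightrightarrows\mathbf{Y}$ is computable (continuous) iff $f:\subseteq\overline{\mathbf{X}}\rightrightarrows\overline{\mathbf{Y}}$ is computable (continuous).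
   Context: A represented space is $(X,\delta_X)$ with $\delta_X:\subseteq\{0,1\}^\omega\to X$ a partial surjection; $f:\subseteq X\rightrightarrows Y$ is computable (continuous) if some computable (continuous) $F:\subseteq\{0,1\}^\omega\to\{0,1\}^\omega$ satisfies $\delta_Y(F(p))\in f(\delta_X(p))$ for all $p\in\operatorname{dom}(f\circ\delta_X)$. Plotkin's $\mathbb{T}=\{0,1,\bot\}$ is represented by $\delta_\mathbb{T}(0^\omega)=\bot$, $\delta_\mathbb{T}(p)=0$ if $\min\{n\mid p(n)=1\}$ is even and $1$ if odd; $\mathbb{T}^\omega$ carries the induced product representation $\delta_{\mathbb{T}^\omega}$. A $\mathbb{T}^\omega$-represented space is a set with a partial surjection $\psi:\subseteq\mathbb{T}^\omega\to X$; since $\{0,1\}^\omega\subseteq\mathbb{T}^\omega$, every represented space is a $\mathbb{T}^\omega$-represented space. A multivalued $F:\subseteq\mathbb{T}^\omega\rightrightarrows\mathbb{T}^\omega$ is computable (continuous) if it is so as a multivalued map of the represented space $(\mathbb{T}^\omega,\delta_{\mathbb{T}^\omega})$ to itself. $F$ is a $\mathbb{T}^\omega$-realizer of $f:\subseteq X\rightrightarrows Y$ if $\emptyset\neq\psi_Y(F(p))\subseteq f(\psi_X(p))$ for all $p\in\operatorname{dom}(f\circ\psi_X)$; $f$ is computable (continuous) between $\mathbb{T}^\omega$-represented spaces if it has a computable (continuous) $\mathbb{T}^\omega$-realizer. -}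

module Defs where

open import Data.Nat using (ℕ; zero; suc; _+_; _*_; _∸_; _^_; _<_; _%_)
open import Data.Bool using (Bool; true; false)
open import Data.List using (List; []; _∷_; applyUpTo)
open import Data.Maybe using (Maybe; just; nothing)
open import Data.Vec as V using (Vec; []; _∷_)
open import Data.Fin using (Fin)
open import Data.Product using (Σ; _×_; ∃)
open import Data.Unit using (⊤)
open import Relation.Binary.PropositionalEquality using (_≡_)

Cantor : Set
Cantor = ℕ → Bool

prefix : Cantor → ℕ → List Bool
prefix p k = applyUpTo p k

-- bijective binary coding of words {0,1}* ≅ ℕ
encodeW : List Bool → ℕ
encodeW []          = 0
encodeW (false ∷ w) = 1 + 2 * encodeW w
encodeW (true  ∷ w) = 2 + 2 * encodeW w

encodeM : Maybe Bool → ℕ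
encodeM nothing      = 0
encodeM (just false) = 1
encodeM (just true)  = 2

data PR : ℕ → Set where
  pz : ∀ {n} → PR n
  ps : PR 1
  pπ : ∀ {n} → Fin n → PR n
  pc : ∀ {m n} → PR m → Vec (PR n) m → PR n
  pr : ∀ {n} → PR n → PR (suc (suc n)) → PR (suc n)
  pμ : ∀ {n} → PR (suc n) → PR n

data Eval : ∀ {n} → PR n → Vec ℕ n → ℕ → Set
data Evals : ∀ {m n} → Vec (PR n) m → Vec ℕ n → Vec ℕ m → Set

data Eval where
  ez  : ∀ {n} {xs : Vec ℕ n} → Eval (pz {n}) xs 0
  es  : ∀ {x} → Eval ps (x ∷ []) (suc x)
  eπ  : ∀ {n} {xs : Vec ℕ n} (i : Fin n) → Eval (pπ i) xs (V.lookup xs i)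
  ec  : ∀ {m n} {f : PR m} {gs : Vec (PR n) m} {xs : Vec ℕ n} {ys : Vec ℕ m} {y : ℕ} →
        Evals gs xs ys → Eval f ys y → Eval (pc f gs) xs y
  er0 : ∀ {n} {g : PR n} {h : PR (suc (suc n))} {xs : Vec ℕ n} {y : ℕ} →
        Eval g xs y → Eval (pr g h) (0 ∷ xs) y
  erS : ∀ {n} {g : PR n} {h : PR (suc (suc n))} {k : ℕ} {xs : Vec ℕ n} {r y : ℕ} →
        Eval (pr g h) (k ∷ xs) r → Eval h (k ∷ r ∷ xs) y → Eval (pr g h) (suc k ∷ xs) y
  eμ  : ∀ {n} {f : PR (suc n)} {xs : Vec ℕ n} {y : ℕ} →
        Eval f (y ∷ xs) 0 →
        (∀ z → z < y → Σ ℕ (λ k → Eval f (z ∷ xs) (suc k))) →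
        Eval (pμ f) xs y

data Evals where
  []  : ∀ {n} {xs : Vec ℕ n} → Evals [] xs []
  _∷_ : ∀ {m n} {g : PR n} {gs : Vec (PR n) m} {xs : Vec ℕ n} {y : ℕ} {ys : Vec ℕ m} →
        Eval g xs y → Evals gs xs ys → Evals (g ∷ gs) xs (y ∷ ys)

-- A machine m decides, for output position n and input prefix w,
-- whether the n-th output bit is already determined (just b) or not.

Machine : Set
Machine = ℕ → List Bool → Maybe Bool

Outputs : Machine → Cantor → Cantor → Set
Outputs m p q = ∀ n → Σ ℕ λ k →
  (m n (prefix p k) ≡ just (q n)) × (∀ j → j < k → m n (prefix p j) ≡ nothing)

ComputableMachine : Machine → Set
ComputableMachine m =
  Σ (PR 2) λ c → ∀ n w → Eval c (n ∷ encodeW w ∷ []) (encodeM (m n w))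

data Mode : Set where
  computable continuous : Mode

Admissible : Mode → Machine → Set
Admissible computable m = ComputableMachine m
Admissible continuous m = ⊤

-- Represented spaces. A partial map δ :⊆ {0,1}^ω → X is given as its graph.

IsRepresentation : {X : Set} → (Cantor → X → Set) → Set
IsRepresentation {X} δ =
  (∀ p q x y → (∀ n → p n ≡ q n) → δ p x → δ q y → x ≡ y) ×
  -- graph of a function on the set {0,1}^ω (closed under pointwise equality)
  (∀ p q x → (∀ n → p n ≡ q n) → δ p x → δ q x) ×
  (∀ x → Σ Cantor λ p → δ p x)

-- multivalued f :⊆ X ⇉ Y is given by its graph; dom f = {x | ∃ y. f x y}.
-- f computable/continuous between represented spaces: there is a
-- (computable) machine which, on every p ∈ dom(f ∘ δX), outputs some q
-- with δY(q) ∈ f(δX(p)).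
Computable : Mode → {X Y : Set} → (Cantor → X → Set) → (Cantor → Y → Set) →
             (X → Y → Set) → Set
Computable mode {X} {Y} δX δY f =
  Σ Machine λ m → Admissible mode m ×
    (∀ p x → δX p x → Σ Y (λ y → f x y) →
       Σ Cantor λ q → Outputs m p q × Σ Y (λ y → δY q y × f x y))

data 𝕋 : Set where
  𝟎 𝟏 ⊥T : 𝕋

FirstOne : Cantor → ℕ → Set
FirstOne p n = (p n ≡ true) × (∀ k → k < n → p k ≡ false)

δ𝕋 : Cantor → 𝕋 → Set
δ𝕋 p ⊥T = ∀ n → p n ≡ false
δ𝕋 p 𝟎  = Σ ℕ λ n → FirstOne p n × (n % 2 ≡ 0)
δ𝕋 p 𝟏  = Σ ℕ λ n → FirstOne p n × (n % 2 ≡ 1)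

Tω : Set
Tω = ℕ → 𝕋

pair : ℕ → ℕ → ℕ
pair i j = 2 ^ i * (2 * j + 1) ∸ 1

δTω : Cantor → Tω → Set
δTω p t = ∀ i → δ𝕋 (λ j → p (pair i j)) (t i)

IsTRepresentation : {X : Set} → (Tω → X → Set) → Set
IsTRepresentation {X} ψ =
  (∀ s t x y → (∀ n → s n ≡ t n) → ψ s x → ψ t y → x ≡ y) ×
  (∀ s t x → (∀ n → s n ≡ t n) → ψ s x → ψ t x) ×
  (∀ x → Σ Tω λ t → ψ t x)

TMapComputable : Mode → (Tω → Tω → Set) → Set
TMapComputable mode F = Computable mode δTω δTω F

-- F is a T^ω-realizer of f:  ∅ ≠ ψY(F(t)) ⊆ f(ψX(t)) for t ∈ dom(f ∘ ψX),
-- where (composition of multivalued maps) ψY(F(t)) is defined only if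
-- F(t) ⊆ dom ψY.
TRealizer : {X Y : Set} → (Tω → X → Set) → (Tω → Y → Set) → (X → Y → Set) →
            (Tω → Tω → Set) → Set
TRealizer {X} {Y} ψX ψY f F =
  ∀ t x → ψX t x → Σ Y (λ y → f x y) →
    Σ Tω (λ t' → F t t') ×
    (∀ t' → F t t' → Σ Y λ y → ψY t' y × f x y)

TComputable : Mode → {X Y : Set} → (Tω → X → Set) → (Tω → Y → Set) →
              (X → Y → Set) → Set₁
TComputable mode ψX ψY f =
  Σ (Tω → Tω → Set) λ F → TMapComputable mode F × TRealizer ψX ψY f F

ι : Bool → 𝕋
ι false = 𝟎
ι true  = 𝟏

-- a represented space viewed as a T^ω-represented space ({0,1}^ω ⊆ T^ω)
asTRep : {X : Set} → (Cantor → X → Set) → Tω → X → Set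
asTRep δ t x = Σ Cantor λ p → (∀ n → t n ≡ ι (p n)) × δ p x

induced : {X : Set} → (Tω → X → Set) → Cantor → X → Set
induced ψ p x = Σ Tω λ t → δTω p t × ψ t x

-- A {0,1}-sequence q and a name of ι ∘ q in T^ω translate into each other by computable machines:
-- the first 1 of the i-th subsequence of such a name sits at an index of parity q i, and toName q is
-- one such name. Composing a machine with these translations on either side turns realizers of one
-- kind into realizers of the other, which is (1); (2) holds because a machine on Cantor space is
-- directly a realizer for the induced representations as well as for T^ω. Every machine built here
-- is an expression over oracles for the given machines, compiled into a μ-recursive code, so
-- computability is preserved; for continuity the same machines serve.

module Submission where

open import Defs
open import Data.Product using (_×_; Σ; _,_; proj₁; proj₂)
open import Function.Bundles using (_⇔_; mk⇔)
open import Data.Nat using (ℕ; zero; suc; _<?_; _+_; _*_; _∸_; _^_; _<_; _≤_; z≤n; s≤s; pred; _%_; _⊓_; _⊔_)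
open import Data.Nat.Properties
open import Data.Nat.DivMod using ([m+kn]%n≡m%n)
open import Data.Fin using (Fin; zero; suc)
open import Data.Vec using (Vec; []; _∷_; lookup; tabulate)
open import Data.Vec.Properties using (tabulate∘lookup)
open import Data.List using (List; []; _∷_; _∷ʳ_; length; drop)
open import Data.List.Properties using (length-applyUpTo; applyUpTo-∷ʳ; drop-drop; drop-all)
open import Data.Maybe using (Maybe; just; nothing)
open import Data.Maybe.Properties using (just-injective)
open import Data.Bool using (Bool; true; false; not)
open import Data.Unit using (tt)
open import Data.Sum using (_⊎_; inj₁; inj₂) renaming (map to ⊎-map)
open import Data.Empty using (⊥-elim)
open import Relation.Nullary using (¬_; yes; no)
open import Relation.Binary.Definitions using (tri<; tri≈; tri>)
open import Relation.Binary.PropositionalEquality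
open import Data.Nat.Solver using (module +-*-Solver)

ifz : ℕ → ℕ → ℕ → ℕ
ifz zero    a b = a
ifz (suc _) a b = b

ADD : PR 2
ADD = pr (pπ zero) (pc ps (pπ (suc zero) ∷ []))

eval-ADD : ∀ a b → Eval ADD (a ∷ b ∷ []) (a + b)
eval-ADD zero    b = er0 (eπ zero)
eval-ADD (suc a) b = erS (eval-ADD a b) (ec (eπ (suc zero) ∷ []) es)

PRED : PR 1
PRED = pr pz (pπ zero)

eval-PRED : ∀ a → Eval PRED (a ∷ []) (pred a)
eval-PRED zero    = er0 ez
eval-PRED (suc a) = erS (eval-PRED a) (eπ zero)

SUB-flipped : PR 2
SUB-flipped = pr (pπ zero) (pc PRED (pπ (suc zero) ∷ []))

eval-SUB-flipped : ∀ b a → Eval SUB-flipped (b ∷ a ∷ []) (a ∸ b)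
eval-SUB-flipped zero    a = er0 (eπ zero)
eval-SUB-flipped (suc b) a = subst (Eval SUB-flipped (suc b ∷ a ∷ [])) (pred[m∸n]≡m∸[1+n] a b)
  (erS (eval-SUB-flipped b a) (ec (eπ (suc zero) ∷ []) (eval-PRED (a ∸ b))))

SUB : PR 2
SUB = pc SUB-flipped (pπ (suc zero) ∷ pπ zero ∷ [])

eval-SUB : ∀ a b → Eval SUB (a ∷ b ∷ []) (a ∸ b)
eval-SUB a b = ec (eπ (suc zero) ∷ eπ zero ∷ []) (eval-SUB-flipped b a)

MUL : PR 2
MUL = pr pz (pc ADD (pπ (suc (suc zero)) ∷ pπ (suc zero) ∷ []))

eval-MUL : ∀ a b → Eval MUL (a ∷ b ∷ []) (a * b)
eval-MUL zero    b = er0 ez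
eval-MUL (suc a) b = erS (eval-MUL a b) (ec (eπ (suc (suc zero)) ∷ eπ (suc zero) ∷ []) (eval-ADD b (a * b)))

IFZ : PR 3
IFZ = pr (pπ zero) (pπ (suc (suc (suc zero))))

eval-IFZ : ∀ a b c → Eval IFZ (a ∷ b ∷ c ∷ []) (ifz a b c)
eval-IFZ zero    b c = er0 (eπ zero)
eval-IFZ (suc a) b c = erS (eval-IFZ a b c) (eπ (suc (suc (suc zero))))

eval-projections : ∀ {n m} (xs : Vec ℕ n) (ρ : Fin m → Fin n) →
  Evals (tabulate (λ i → pπ (ρ i))) xs (tabulate (λ i → lookup xs (ρ i)))
eval-projections {m = zero}  xs ρ = []
eval-projections {m = suc m} xs ρ = eπ (ρ zero) ∷ eval-projections xs (λ i → ρ (suc i))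

eval-identity : ∀ {n} (xs : Vec ℕ n) → Evals (tabulate pπ) xs xs
eval-identity xs = subst (Evals (tabulate pπ) xs) (tabulate∘lookup xs) (eval-projections xs (λ i → i))

infixl 6 _⊕_ _⊝_
infixl 7 _⊗_

data Exp (k : ℕ) : ℕ → Set where
  var         : ∀ {n} → Fin n → Exp k n
  zer         : ∀ {n} → Exp k n
  sc          : ∀ {n} → Exp k n → Exp k n
  _⊕_ _⊝_ _⊗_ : ∀ {n} → Exp k n → Exp k n → Exp k n
  ifzE        : ∀ {n} → Exp k n → Exp k n → Exp k n → Exp k n
  rec         : ∀ {n} → Exp k n → Exp k (suc (suc n)) → Exp k n → Exp k n
  app         : ∀ {m n} → Exp k m → Vec (Exp k n) m → Exp k n
  call        : ∀ {n} → Fin k → Exp k n → Exp k n → Exp k n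

module Semantics {k} (O : Fin k → ℕ → ℕ → ℕ) where
  mutual
    ⟦_⟧ : ∀ {n} → Exp k n → Vec ℕ n → ℕ
    ⟦ var i ⟧      xs = lookup xs i
    ⟦ zer ⟧        xs = 0
    ⟦ sc e ⟧       xs = suc (⟦ e ⟧ xs)
    ⟦ a ⊕ b ⟧      xs = ⟦ a ⟧ xs + ⟦ b ⟧ xs
    ⟦ a ⊝ b ⟧      xs = ⟦ a ⟧ xs ∸ ⟦ b ⟧ xs
    ⟦ a ⊗ b ⟧      xs = ⟦ a ⟧ xs * ⟦ b ⟧ xs
    ⟦ ifzE c a b ⟧ xs = ifz (⟦ c ⟧ xs) (⟦ a ⟧ xs) (⟦ b ⟧ xs)
    ⟦ rec g h a ⟧  xs = iterate g h xs (⟦ a ⟧ xs)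
    ⟦ app f as ⟧   xs = ⟦ f ⟧ (⟦ as ⟧* xs)
    ⟦ call i a b ⟧ xs = O i (⟦ a ⟧ xs) (⟦ b ⟧ xs)

    iterate : ∀ {n} → Exp k n → Exp k (suc (suc n)) → Vec ℕ n → ℕ → ℕ
    iterate g h xs zero    = ⟦ g ⟧ xs
    iterate g h xs (suc j) = ⟦ h ⟧ (j ∷ iterate g h xs j ∷ xs)

    ⟦_⟧* : ∀ {n m} → Vec (Exp k n) m → Vec ℕ n → Vec ℕ m
    ⟦ [] ⟧*        xs = []
    ⟦ e ∷ rest ⟧* xs = ⟦ e ⟧ xs ∷ ⟦ rest ⟧* xs

module Compile {k} (O : Fin k → ℕ → ℕ → ℕ) (code : Fin k → PR 2)
               (eval-code : ∀ i a b → Eval (code i) (a ∷ b ∷ []) (O i a b)) where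
  open Semantics O

  mutual
    compile : ∀ {n} → Exp k n → PR n
    compile (var i)      = pπ i
    compile zer          = pz
    compile (sc e)       = pc ps (compile e ∷ [])
    compile (a ⊕ b)      = pc ADD (compile a ∷ compile b ∷ [])
    compile (a ⊝ b)      = pc SUB (compile a ∷ compile b ∷ [])
    compile (a ⊗ b)      = pc MUL (compile a ∷ compile b ∷ [])
    compile (ifzE c a b) = pc IFZ (compile c ∷ compile a ∷ compile b ∷ [])
    compile (rec g h a)  = pc (pr (compile g) (compile h)) (compile a ∷ tabulate pπ)
    compile (app f as)   = pc (compile f) (compile* as)
    compile (call i a b) = pc (code i) (compile a ∷ compile b ∷ [])

    compile* : ∀ {n m} → Vec (Exp k n) m → Vec (PR n) m
    compile* []         = []
    compile* (e ∷ rest) = compile e ∷ compile* rest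

  mutual
    eval-compile : ∀ {n} (e : Exp k n) xs → Eval (compile e) xs (⟦ e ⟧ xs)
    eval-compile (var i)      xs = eπ i
    eval-compile zer          xs = ez
    eval-compile (sc e)       xs = ec (eval-compile e xs ∷ []) es
    eval-compile (a ⊕ b)      xs = ec (eval-compile a xs ∷ eval-compile b xs ∷ []) (eval-ADD _ _)
    eval-compile (a ⊝ b)      xs = ec (eval-compile a xs ∷ eval-compile b xs ∷ []) (eval-SUB _ _)
    eval-compile (a ⊗ b)      xs = ec (eval-compile a xs ∷ eval-compile b xs ∷ []) (eval-MUL _ _)
    eval-compile (ifzE c a b) xs =
      ec (eval-compile c xs ∷ eval-compile a xs ∷ eval-compile b xs ∷ []) (eval-IFZ _ _ _)
    eval-compile (rec g h a)  xs = ec (eval-compile a xs ∷ eval-identity xs) (eval-iterate g h xs (⟦ a ⟧ xs))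
    eval-compile (app f as)   xs = ec (eval-compile* as xs) (eval-compile f (⟦ as ⟧* xs))
    eval-compile (call i a b) xs = ec (eval-compile a xs ∷ eval-compile b xs ∷ []) (eval-code i _ _)

    eval-iterate : ∀ {n} (g : Exp k n) h xs j → Eval (pr (compile g) (compile h)) (j ∷ xs) (iterate g h xs j)
    eval-iterate g h xs zero    = er0 (eval-compile g xs)
    eval-iterate g h xs (suc j) = erS (eval-iterate g h xs j) (eval-compile h _)

    eval-compile* : ∀ {n m} (as : Vec (Exp k n) m) xs → Evals (compile* as) xs (⟦ as ⟧* xs)
    eval-compile* []         xs = []
    eval-compile* (e ∷ rest) xs = eval-compile e xs ∷ eval-compile* rest xs

bit : Bool → ℕ
bit false = 0
bit true  = 1

mod2 : ℕ → ℕ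
mod2 zero    = 0
mod2 (suc n) = 1 ∸ mod2 n

div2 : ℕ → ℕ
div2 zero    = 0
div2 (suc n) = div2 n + mod2 n

mod2≤1 : ∀ n → mod2 n ≤ 1
mod2≤1 zero    = z≤n
mod2≤1 (suc n) = m∸n≤m 1 (mod2 n)

mod2-+2 : ∀ n → mod2 (2 + n) ≡ mod2 n
mod2-+2 n with mod2 n | mod2≤1 n
... | 0 | _ = refl
... | 1 | _ = refl
... | suc (suc _) | s≤s ()

div2-+2 : ∀ n → div2 (2 + n) ≡ suc (div2 n)
div2-+2 n with mod2 n | mod2≤1 n
... | 0 | _ = trans (cong (_+ 1) (+-identityʳ (div2 n))) (+-comm (div2 n) 1)
... | 1 | _ = trans (+-identityʳ (div2 n + 1)) (+-comm (div2 n) 1)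
... | suc (suc _) | s≤s ()

+-2*suc : ∀ a e → a + 2 * suc e ≡ 2 + (a + 2 * e)
+-2*suc = solve 2 (λ a e → a :+ con 2 :* (con 1 :+ e) := con 2 :+ (a :+ con 2 :* e)) refl
  where open +-*-Solver

mod2-bit+2* : ∀ b e → mod2 (bit b + 2 * e) ≡ bit b
mod2-bit+2* false zero    = refl
mod2-bit+2* true  zero    = refl
mod2-bit+2* b     (suc e) = trans (cong mod2 (+-2*suc (bit b) e)) (trans (mod2-+2 (bit b + 2 * e)) (mod2-bit+2* b e))

div2-bit+2* : ∀ b e → div2 (bit b + 2 * e) ≡ e
div2-bit+2* false zero    = refl
div2-bit+2* true  zero    = refl
div2-bit+2* b     (suc e) = trans (cong div2 (+-2*suc (bit b) e)) (trans (div2-+2 (bit b + 2 * e)) (cong suc (div2-bit+2* b e)))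

mod2+2*div2 : ∀ n → mod2 n + 2 * div2 n ≡ n
mod2+2*div2 zero          = refl
mod2+2*div2 (suc zero)    = refl
mod2+2*div2 (suc (suc n)) = begin
  mod2 (2 + n) + 2 * div2 (2 + n)  ≡⟨ cong₂ (λ a b → a + 2 * b) (mod2-+2 n) (div2-+2 n) ⟩
  mod2 n + 2 * suc (div2 n)        ≡⟨ +-2*suc (mod2 n) (div2 n) ⟩
  2 + (mod2 n + 2 * div2 n)        ≡⟨ cong (2 +_) (mod2+2*div2 n) ⟩
  2 + n                            ∎
  where open ≡-Reasoning

div2≤ : ∀ n → div2 n ≤ n
div2≤ n = ≤-trans (m≤n*m (div2 n) 2)
  (≤-trans (m≤n+m (2 * div2 n) (mod2 n)) (≤-reflexive (mod2+2*div2 n)))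

mod2≡%2 : ∀ n → mod2 n ≡ n % 2
mod2≡%2 zero          = refl
mod2≡%2 (suc zero)    = refl
mod2≡%2 (suc (suc n)) =
  trans (mod2-+2 n) (trans (mod2≡%2 n) (sym (trans (cong (_% 2) (+-comm 2 n)) ([m+kn]%n≡m%n n 1 2))))

ltᴺ eqᴺ : ℕ → ℕ → ℕ
ltᴺ a b = ifz (b ∸ a) 0 1
eqᴺ a b = ifz ((a ∸ b) + (b ∸ a)) 1 0

ltᴺ-< : ∀ {a b} → a < b → ltᴺ a b ≡ 1
ltᴺ-< {a} {b} a<b with b ∸ a | m>n⇒m∸n≢0 a<b
... | zero  | b∸a≢0 = ⊥-elim (b∸a≢0 refl)
... | suc _ | _     = refl

ltᴺ-≥ : ∀ {a b} → b ≤ a → ltᴺ a b ≡ 0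
ltᴺ-≥ b≤a rewrite m≤n⇒m∸n≡0 b≤a = refl

eqᴺ-refl : ∀ a → eqᴺ a a ≡ 1
eqᴺ-refl a rewrite n∸n≡0 a = refl

eqᴺ-≢ : ∀ {a b} → a ≢ b → eqᴺ a b ≡ 0
eqᴺ-≢ {a} {b} a≢b with a ∸ b in a∸b | b ∸ a in b∸a
... | suc _ | _     = refl
... | zero  | suc _ = refl
... | zero  | zero  = ⊥-elim (a≢b (≤-antisym (m∸n≡0⇒m≤n a∸b) (m∸n≡0⇒m≤n b∸a)))

FirstNonzero : (ℕ → ℕ) → ℕ → Set
FirstNonzero h K = h K ≢ 0 × (∀ j → j < K → h j ≡ 0)

-- μ< f b is the least z < b with f z ≢ 0, and b if there is none.
μ< : (ℕ → ℕ) → ℕ → ℕ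
μ< f zero    = 0
μ< f (suc k) = ifz (ltᴺ (μ< f k) k) (ifz (f k) (suc k) k) (μ< f k)

μ<-≤ : ∀ f b → μ< f b ≤ b

μ<-step-< : ∀ f k → μ< f k < k → μ< f (suc k) ≡ μ< f k
μ<-step-< f k lt rewrite ltᴺ-< lt = refl

μ<-step-≡ : ∀ f k → μ< f k ≡ k → μ< f (suc k) ≡ ifz (f k) (suc k) k
μ<-step-≡ f k eq rewrite eq | ltᴺ-≥ {k} {k} ≤-refl = refl

μ<-≤ f zero    = z≤n
μ<-≤ f (suc k) with m≤n⇒m<n∨m≡n (μ<-≤ f k)
... | inj₁ lt rewrite μ<-step-< f k lt = m≤n⇒m≤1+n (μ<-≤ f k)
... | inj₂ eq rewrite μ<-step-≡ f k eq with f k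
...   | zero  = ≤-refl
...   | suc _ = n≤1+n k

μ<-nonzero : ∀ f b → μ< f b < b → f (μ< f b) ≢ 0
μ<-nonzero f (suc k) h with m≤n⇒m<n∨m≡n (μ<-≤ f k)
... | inj₁ lt rewrite μ<-step-< f k lt = μ<-nonzero f k lt
... | inj₂ eq rewrite μ<-step-≡ f k eq with f k in fk
...   | zero  = ⊥-elim (<-irrefl refl h)
...   | suc _ = λ f≡0 → 0≢1+n (trans (sym f≡0) fk)

μ<-below : ∀ f b z → z < μ< f b → f z ≡ 0
μ<-below f (suc k) z h with m≤n⇒m<n∨m≡n (μ<-≤ f k)
... | inj₁ lt rewrite μ<-step-< f k lt = μ<-below f k z h
... | inj₂ eq rewrite μ<-step-≡ f k eq with f k in fk
...   | suc _ = μ<-below f k z (subst (z <_) (sym eq) h)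
...   | zero with m≤n⇒m<n∨m≡n (≤-pred h)
...     | inj₁ z<k  = μ<-below f k z (subst (z <_) (sym eq) z<k)
...     | inj₂ refl = fk

μ<-cong : ∀ f g b → (∀ z → f z ≡ g z) → μ< f b ≡ μ< g b
μ<-cong f g zero    f≗g = refl
μ<-cong f g (suc k) f≗g rewrite μ<-cong f g k f≗g | f≗g k = refl

μ<-first : ∀ f b → μ< f b < b → FirstNonzero f (μ< f b)
μ<-first f b lt = μ<-nonzero f b lt , μ<-below f b

μ<-exact : ∀ f {b K} → FirstNonzero f K → K < b → μ< f b ≡ K
μ<-exact f {b} {K} (fK≢0 , below) K<b with <-cmp (μ< f b) K
... | tri≈ _ eq _ = eq
... | tri< lt _ _ = ⊥-elim (μ<-nonzero f b (<-trans lt K<b) (below _ lt))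
... | tri> _ _ gt = ⊥-elim (fK≢0 (μ<-below f b K gt))

μ<-found : ∀ f {b z} → f z ≢ 0 → z < b → μ< f b < b
μ<-found f {b} {z} fz≢0 z<b with m≤n⇒m<n∨m≡n (μ<-≤ f b)
... | inj₁ lt = lt
... | inj₂ eq = ⊥-elim (fz≢0 (μ<-below f b z (subst (z <_) (sym eq) z<b)))

-- The value of h at its first non-zero argument k ≤ b, and 0 if there is none.
firstNonzero : (ℕ → ℕ) → ℕ → ℕ
firstNonzero h b = ifz (ltᴺ (μ< h (suc b)) (suc b)) 0 (h (μ< h (suc b)))

firstNonzero-cases : ∀ h b → firstNonzero h b ≡ 0 ⊎
  Σ ℕ λ K → K ≤ b × FirstNonzero h K × firstNonzero h b ≡ h K
firstNonzero-cases h b with m≤n⇒m<n∨m≡n (μ<-≤ h (suc b))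
... | inj₁ lt rewrite ltᴺ-< lt = inj₂ (μ< h (suc b) , ≤-pred lt , μ<-first h (suc b) lt , refl)
... | inj₂ eq rewrite eq | ltᴺ-≥ {suc b} {suc b} ≤-refl = inj₁ refl

firstNonzero-hit : ∀ h {b K} → FirstNonzero h K → K ≤ b → firstNonzero h b ≡ h K
firstNonzero-hit h first K≤b rewrite μ<-exact h first (s≤s K≤b) | ltᴺ-< (s≤s K≤b) = refl

firstNonzero-none : ∀ h b → (∀ k → k ≤ b → h k ≡ 0) → firstNonzero h b ≡ 0
firstNonzero-none h b zeros with firstNonzero-cases h b
... | inj₁ none                          = none
... | inj₂ (K , K≤b , (hK≢0 , _) , _) = ⊥-elim (hK≢0 (zeros K K≤b))

firstNonzero-cong : ∀ h h' b → (∀ z → h z ≡ h' z) → firstNonzero h b ≡ firstNonzero h' b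
firstNonzero-cong h h' b h≗h' rewrite μ<-cong h h' (suc b) h≗h' | h≗h' (μ< h' (suc b)) = refl

allPositive : (ℕ → ℕ) → ℕ → ℕ
allPositive d zero    = 1
allPositive d (suc j) = allPositive d j * ifz (d j) 0 1

allPositive-≢0 : ∀ d j → allPositive d j ≢ 0 → ∀ m → m < j → d m ≢ 0
allPositive-≢0 d (suc j) all≢0 m m<1+j with m≤n⇒m<n∨m≡n (≤-pred m<1+j)
... | inj₁ m<j  = allPositive-≢0 d j (λ all≡0 → all≢0 (cong (_* ifz (d j) 0 1) all≡0)) m m<j
... | inj₂ refl = λ dm≡0 →
  all≢0 (trans (cong (λ v → allPositive d m * ifz v 0 1) dm≡0) (*-zeroʳ (allPositive d m)))

allPositive-≡1 : ∀ d j → (∀ m → m < j → d m ≢ 0) → allPositive d j ≡ 1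
allPositive-≡1 d zero    _        = refl
allPositive-≡1 d (suc j) positive
  rewrite allPositive-≡1 d j (λ m m<j → positive m (m≤n⇒m≤1+n m<j)) with d j | positive j ≤-refl
... | zero  | dj≢0 = ⊥-elim (dj≢0 refl)
... | suc _ | _    = refl

encodeW-∷ : ∀ b w → encodeW (b ∷ w) ≡ suc (bit b + 2 * encodeW w)
encodeW-∷ false w = refl
encodeW-∷ true  w = refl

bit-injective : ∀ {b b'} → bit b ≡ bit b' → b ≡ b'
bit-injective {false} {false} _ = refl
bit-injective {true}  {true}  _ = refl

encodeW-injective : ∀ {w w'} → encodeW w ≡ encodeW w' → w ≡ w'
encodeW-injective {[]}    {[]}      _  = refl
encodeW-injective {[]}    {b ∷ w'}  eq = ⊥-elim (0≢1+n (trans eq (encodeW-∷ b w')))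
encodeW-injective {b ∷ w} {[]}      eq = ⊥-elim (0≢1+n (trans (sym eq) (encodeW-∷ b w)))
encodeW-injective {b ∷ w} {b' ∷ w'} eq =
  cong₂ _∷_
    (bit-injective (trans (sym (mod2-bit+2* b (encodeW w))) (trans (cong mod2 digits) (mod2-bit+2* b' (encodeW w')))))
    (encodeW-injective (trans (sym (div2-bit+2* b (encodeW w))) (trans (cong div2 digits) (div2-bit+2* b' (encodeW w')))))
  where digits : bit b + 2 * encodeW w ≡ bit b' + 2 * encodeW w'
        digits = suc-injective (trans (sym (encodeW-∷ b w)) (trans eq (encodeW-∷ b' w')))

toBool : ℕ → Bool
toBool zero    = false
toBool (suc _) = true

bit-toBool : ∀ v → v ≤ 1 → bit (toBool v) ≡ v
bit-toBool zero       _ = refl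
bit-toBool (suc zero) _ = refl
bit-toBool (suc (suc _)) (s≤s ())

-- The first argument is fuel, enough once it bounds the code.
decodeWith : ℕ → ℕ → List Bool
decodeWith zero    _       = []
decodeWith (suc f) zero    = []
decodeWith (suc f) (suc n) = toBool (mod2 n) ∷ decodeWith f (div2 n)

encodeW-decodeWith : ∀ f n → n ≤ f → encodeW (decodeWith f n) ≡ n
encodeW-decodeWith zero    zero    _       = refl
encodeW-decodeWith (suc f) zero    _       = refl
encodeW-decodeWith (suc f) (suc n) (s≤s n≤f) = begin
  encodeW (toBool (mod2 n) ∷ decodeWith f (div2 n))            ≡⟨ encodeW-∷ (toBool (mod2 n)) _ ⟩
  suc (bit (toBool (mod2 n)) + 2 * encodeW (decodeWith f (div2 n)))
    ≡⟨ cong₂ (λ a b → suc (a + 2 * b)) (bit-toBool (mod2 n) (mod2≤1 n))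
             (encodeW-decodeWith f (div2 n) (≤-trans (div2≤ n) n≤f)) ⟩
  suc (mod2 n + 2 * div2 n)                                     ≡⟨ cong suc (mod2+2*div2 n) ⟩
  suc n                                                         ∎
  where open ≡-Reasoning

decodeW : ℕ → List Bool
decodeW n = decodeWith n n

encodeW-decodeW : ∀ n → encodeW (decodeW n) ≡ n
encodeW-decodeW n = encodeW-decodeWith n n ≤-refl

decodeW-encodeW : ∀ w → decodeW (encodeW w) ≡ w
decodeW-encodeW w = encodeW-injective (encodeW-decodeW (encodeW w))

length≤encodeW : ∀ w → length w ≤ encodeW w
length≤encodeW []      = z≤n
length≤encodeW (b ∷ w) rewrite encodeW-∷ b w =
  s≤s (≤-trans (length≤encodeW w) (≤-trans (m≤n*m (encodeW w) 2) (m≤n+m (2 * encodeW w) (bit b))))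

prefix-length≤encodeW : ∀ p L → L ≤ encodeW (prefix p L)
prefix-length≤encodeW p L = subst (_≤ encodeW (prefix p L)) (length-applyUpTo p L) (length≤encodeW (prefix p L))

encodeW-∷ʳ : ∀ w b → encodeW (w ∷ʳ b) ≡ encodeW w + suc (bit b) * 2 ^ length w
encodeW-∷ʳ []      false = refl
encodeW-∷ʳ []      true  = refl
encodeW-∷ʳ (c ∷ w) b = begin
  encodeW (c ∷ (w ∷ʳ b))
    ≡⟨ encodeW-∷ c (w ∷ʳ b) ⟩
  suc (bit c + 2 * encodeW (w ∷ʳ b))
    ≡⟨ cong (λ e → suc (bit c + 2 * e)) (encodeW-∷ʳ w b) ⟩
  suc (bit c + 2 * (encodeW w + suc (bit b) * 2 ^ length w))
    ≡⟨ solve 4 (λ a e s t → con 1 :+ (a :+ con 2 :* (e :+ s :* t)) := con 1 :+ (a :+ con 2 :* e) :+ s :* (con 2 :* t))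
             refl (bit c) (encodeW w) (suc (bit b)) (2 ^ length w) ⟩
  suc (bit c + 2 * encodeW w) + suc (bit b) * 2 ^ length (c ∷ w)
    ≡⟨ cong (_+ suc (bit b) * 2 ^ length (c ∷ w)) (sym (encodeW-∷ c w)) ⟩
  encodeW (c ∷ w) + suc (bit b) * 2 ^ length (c ∷ w)
    ∎
  where open ≡-Reasoning
        open +-*-Solver

tailCode : ℕ → ℕ
tailCode x = div2 (x ∸ 1)

dropCode : ℕ → ℕ → ℕ
dropCode zero    x = x
dropCode (suc j) x = tailCode (dropCode j x)

-- The j-th digit of a code: 1 + the j-th letter inside the word and 0 beyond it.
digit : ℕ → ℕ → ℕ
digit j x = ifz (dropCode j x) 0 (suc (mod2 (dropCode j x ∸ 1)))

headDigit : List Bool → ℕ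
headDigit []      = 0
headDigit (b ∷ _) = suc (bit b)

tailCode-encodeW : ∀ w → tailCode (encodeW w) ≡ encodeW (drop 1 w)
tailCode-encodeW []      = refl
tailCode-encodeW (b ∷ w) rewrite encodeW-∷ b w = div2-bit+2* b (encodeW w)

dropCode-encodeW : ∀ j w → dropCode j (encodeW w) ≡ encodeW (drop j w)
dropCode-encodeW zero    w = refl
dropCode-encodeW (suc j) w = begin
  tailCode (dropCode j (encodeW w)) ≡⟨ cong tailCode (dropCode-encodeW j w) ⟩
  tailCode (encodeW (drop j w))     ≡⟨ tailCode-encodeW (drop j w) ⟩
  encodeW (drop 1 (drop j w))       ≡⟨ cong encodeW (trans (drop-drop j 1 w) (cong (λ n → drop n w) (+-comm j 1))) ⟩
  encodeW (drop (suc j) w)          ∎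
  where open ≡-Reasoning

digit-encodeW : ∀ j w → digit j (encodeW w) ≡ headDigit (drop j w)
digit-encodeW j w rewrite dropCode-encodeW j w with drop j w
... | []    = refl
... | b ∷ u rewrite encodeW-∷ b u = cong suc (mod2-bit+2* b (encodeW u))

headDigit-drop-prefix : ∀ p {j L} → j < L → headDigit (drop j (prefix p L)) ≡ suc (bit (p j))
headDigit-drop-prefix p {zero}  {suc L} _         = refl
headDigit-drop-prefix p {suc j} {suc L} (s≤s j<L) = headDigit-drop-prefix (λ n → p (suc n)) j<L

digit-prefix-< : ∀ p {j L} → j < L → digit j (encodeW (prefix p L)) ≡ suc (bit (p j))
digit-prefix-< p {j} {L} j<L = trans (digit-encodeW j (prefix p L)) (headDigit-drop-prefix p j<L)

digit-prefix-≥ : ∀ p {j L} → L ≤ j → digit j (encodeW (prefix p L)) ≡ 0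
digit-prefix-≥ p {j} {L} L≤j = trans (digit-encodeW j (prefix p L))
  (cong headDigit (drop-all j (prefix p L) (subst (_≤ j) (sym (length-applyUpTo p L)) L≤j)))

-- encodeW w = Σ_{j < length w} digit j (encodeW w) * 2 ^ j
digitsCode : (ℕ → ℕ) → ℕ → ℕ
digitsCode d zero    = 0
digitsCode d (suc k) = digitsCode d k + d k * 2 ^ k

digitsCode-prefix : ∀ d q k → (∀ j → j < k → d j ≡ suc (bit (q j))) → digitsCode d k ≡ encodeW (prefix q k)
digitsCode-prefix d q zero    _      = refl
digitsCode-prefix d q (suc k) digits = begin
  digitsCode d k + d k * 2 ^ k
    ≡⟨ cong₂ (λ c e → c + e * 2 ^ k)
             (digitsCode-prefix d q k (λ j j<k → digits j (m≤n⇒m≤1+n j<k))) (digits k ≤-refl) ⟩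
  encodeW (prefix q k) + suc (bit (q k)) * 2 ^ k
    ≡⟨ cong (λ n → encodeW (prefix q k) + suc (bit (q k)) * 2 ^ n) (sym (length-applyUpTo q k)) ⟩
  encodeW (prefix q k) + suc (bit (q k)) * 2 ^ length (prefix q k)
    ≡⟨ sym (encodeW-∷ʳ (prefix q k) (q k)) ⟩
  encodeW (prefix q k ∷ʳ q k) ≡⟨ cong encodeW (applyUpTo-∷ʳ q k) ⟩
  encodeW (prefix q (suc k))  ∎
  where open ≡-Reasoning

digitsCode-stable : ∀ d L k → (∀ j → L ≤ j → d j ≡ 0) → L ≤ k → digitsCode d k ≡ digitsCode d L
digitsCode-stable d zero zero    _     _     = refl
digitsCode-stable d L    (suc k) zeros L≤1+k with m≤n⇒m<n∨m≡n L≤1+k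
... | inj₂ refl = refl
... | inj₁ L<1+k rewrite zeros k (≤-pred L<1+k) =
  trans (+-identityʳ (digitsCode d k)) (digitsCode-stable d L k zeros (≤-pred L<1+k))

takeCode : ℕ → ℕ → ℕ
takeCode k x = digitsCode (λ j → digit j x) k

takeCode-prefix : ∀ p L k → takeCode k (encodeW (prefix p L)) ≡ encodeW (prefix p (k ⊓ L))
takeCode-prefix p L k with ≤-total k L
... | inj₁ k≤L rewrite m≤n⇒m⊓n≡m k≤L =
  digitsCode-prefix _ p k (λ j j<k → digit-prefix-< p (<-≤-trans j<k k≤L))
... | inj₂ L≤k rewrite m≥n⇒m⊓n≡n L≤k =
  trans (digitsCode-stable _ L k (λ j → digit-prefix-≥ p) L≤k)
        (digitsCode-prefix _ p L (λ j → digit-prefix-< p))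

pair⁺ : ℕ → ℕ → ℕ
pair⁺ i j = 2 ^ i * (2 * j + 1)

pair⁺-zero : ∀ j → pair⁺ 0 j ≡ suc (2 * j)
pair⁺-zero j = trans (+-identityʳ (2 * j + 1)) (+-comm (2 * j) 1)

pair⁺-suc : ∀ i j → pair⁺ (suc i) j ≡ 2 * pair⁺ i j
pair⁺-suc i j = *-assoc 2 (2 ^ i) (2 * j + 1)

j<pair⁺ : ∀ i j → j < pair⁺ i j
j<pair⁺ i j = ≤-trans (s≤s (m≤n*m j 2))
  (≤-trans (≤-reflexive (+-comm 1 (2 * j))) (m≤n*m (2 * j + 1) (2 ^ i) {{m^n≢0 2 i}}))

1≤pair⁺ : ∀ i j → 1 ≤ pair⁺ i j
1≤pair⁺ i j = ≤-trans (s≤s z≤n) (j<pair⁺ i j)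

suc-pair : ∀ i j → suc (pair i j) ≡ pair⁺ i j
suc-pair i j with pair⁺ i j | 1≤pair⁺ i j
... | suc _ | _ = refl

odd≢even : ∀ a b → suc (2 * a) ≢ 2 * b
odd≢even a b eq = 0≢1+n (trans (sym (mod2-bit+2* false b)) (trans (cong mod2 (sym eq)) (mod2-bit+2* true a)))

pair⁺-injective : ∀ i j i' j' → pair⁺ i j ≡ pair⁺ i' j' → i ≡ i' × j ≡ j'
pair⁺-injective zero j zero j' eq rewrite pair⁺-zero j | pair⁺-zero j' =
  refl , *-cancelˡ-≡ j j' 2 (suc-injective eq)
pair⁺-injective zero j (suc i') j' eq rewrite pair⁺-zero j | pair⁺-suc i' j' =
  ⊥-elim (odd≢even j (pair⁺ i' j') eq)
pair⁺-injective (suc i) j zero j' eq rewrite pair⁺-zero j' | pair⁺-suc i j =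
  ⊥-elim (odd≢even j' (pair⁺ i j) (sym eq))
pair⁺-injective (suc i) j (suc i') j' eq rewrite pair⁺-suc i j | pair⁺-suc i' j'
  with pair⁺-injective i j i' j' (*-cancelˡ-≡ (pair⁺ i j) (pair⁺ i' j') 2 eq)
... | refl , refl = refl , refl

pair-injective : ∀ {i j i' j'} → pair i j ≡ pair i' j' → i ≡ i' × j ≡ j'
pair-injective {i} {j} {i'} {j'} eq =
  pair⁺-injective i j i' j' (trans (sym (suc-pair i j)) (trans (cong suc eq) (suc-pair i' j')))

i<pair⁺ : ∀ i j → i < pair⁺ i j
i<pair⁺ zero    j = 1≤pair⁺ 0 j
i<pair⁺ (suc i) j rewrite pair⁺-suc i j =
  subst (_≤ pair⁺ i j + (pair⁺ i j + 0)) (+-comm (suc i) 1)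
        (+-mono-≤ (i<pair⁺ i j) (≤-trans (1≤pair⁺ i j) (m≤m+n (pair⁺ i j) 0)))

i≤pair : ∀ i j → i ≤ pair i j
i≤pair i j = ≤-pred (subst (i <_) (sym (suc-pair i j)) (i<pair⁺ i j))

j≤pair : ∀ i j → j ≤ pair i j
j≤pair i j = ≤-pred (subst (j <_) (sym (suc-pair i j)) (j<pair⁺ i j))

pair-monoʳ-< : ∀ i {j j'} → j < j' → pair i j < pair i j'
pair-monoʳ-< i {j} {j'} j<j' = ≤-pred (subst₂ _<_ (sym (suc-pair i j)) (sym (suc-pair i j'))
  (*-monoʳ-< (2 ^ i) {{m^n≢0 2 i}} (+-monoˡ-< 1 (*-monoʳ-< 2 j<j'))))

least-unique : ∀ {P : ℕ → Set} {m n} →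
  P m → (∀ j → j < m → ¬ P j) → P n → (∀ j → j < n → ¬ P j) → m ≡ n
least-unique {m = m} {n} Pm below-m Pn below-n with <-cmp m n
... | tri≈ _ m≡n _ = m≡n
... | tri< m<n _ _ = ⊥-elim (below-n m m<n Pm)
... | tri> _ _ n<m = ⊥-elim (below-m n n<m Pn)

FirstOne-unique : ∀ {s m n} → FirstOne s m → FirstOne s n → m ≡ n
FirstOne-unique (one , zeros) (one' , zeros') =
  least-unique one (λ j j<m one-j → true≢false (trans (sym one-j) (zeros j j<m)))
               one' (λ j j<n one-j → true≢false (trans (sym one-j) (zeros' j j<n)))
  where true≢false : true ≢ false
        true≢false ()

FirstStage : (ℕ → Maybe Bool) → ℕ → Bool → Set
FirstStage g k b = g k ≡ just b × (∀ j → j < k → g j ≡ nothing)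

FirstStage-unique : ∀ {g k k' b b'} → FirstStage g k b → FirstStage g k' b' → b ≡ b'
FirstStage-unique {g} (gk , below) (gk' , below') = just-injective (trans (sym gk) (trans (cong g k≡k') gk'))
  where
    defined : ∀ {j b} → g j ≡ just b → g j ≢ nothing
    defined gj gj≡nothing with trans (sym gj) gj≡nothing
    ... | ()
    k≡k' = least-unique {P = λ j → g j ≢ nothing}
      (defined gk) (λ j j<k undefined → undefined (below j j<k))
      (defined gk') (λ j j<k' undefined → undefined (below' j j<k'))

decodeM : ℕ → Maybe Bool
decodeM 1 = just false
decodeM 2 = just true
decodeM _ = nothing

encodeM-just : ∀ b → encodeM (just b) ≡ suc (bit b)
encodeM-just false = refl
encodeM-just true  = refl

encodeM-≢0 : ∀ m → encodeM m ≢ 0 → Σ Bool λ b → m ≡ just b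
encodeM-≢0 nothing  ≢0 = ⊥-elim (≢0 refl)
encodeM-≢0 (just b) _  = b , refl

encodeM-≡0 : ∀ {m} → encodeM m ≡ 0 → m ≡ nothing
encodeM-≡0 {nothing}     _ = refl
encodeM-≡0 {just false} ()
encodeM-≡0 {just true}  ()

encodeM-just≢0 : ∀ b → encodeM (just b) ≢ 0
encodeM-just≢0 false ()
encodeM-just≢0 true  ()

decodeM-encodeM : ∀ b → decodeM (encodeM (just b)) ≡ just b
decodeM-encodeM false = refl
decodeM-encodeM true  = refl

δ𝕋-ι : ∀ {s b} → δ𝕋 s (ι b) → Σ ℕ λ n → FirstOne s n × suc (mod2 n) ≡ encodeM (just b)
δ𝕋-ι {b = false} (n , first , even) = n , first , cong suc (trans (mod2≡%2 n) even)
δ𝕋-ι {b = true}  (n , first , odd)  = n , first , cong suc (trans (mod2≡%2 n) odd)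

-- unpairAt c N is suc i if N = pair i c, and 0 if N is not of the form pair _ c.
unpairAt : ℕ → ℕ → ℕ
unpairAt c N = firstNonzero (λ i → eqᴺ (pair i c) N * suc i) N

unpairAt-pair : ∀ c i → unpairAt c (pair i c) ≡ suc i
unpairAt-pair c i = begin
  unpairAt c (pair i c)                  ≡⟨ firstNonzero-hit h (hi≢0 , below) (i≤pair i c) ⟩
  eqᴺ (pair i c) (pair i c) * suc i      ≡⟨ cong (_* suc i) (eqᴺ-refl (pair i c)) ⟩
  1 * suc i                              ≡⟨ *-identityˡ (suc i) ⟩
  suc i                                  ∎
  where
    open ≡-Reasoning
    h = λ i' → eqᴺ (pair i' c) (pair i c) * suc i'
    hi≢0 : h i ≢ 0
    hi≢0 hi≡0 = 0≢1+n (trans (sym hi≡0) (trans (cong (_* suc i) (eqᴺ-refl (pair i c))) (*-identityˡ (suc i))))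
    below : ∀ j → j < i → h j ≡ 0
    below j j<i = cong (_* suc j) (eqᴺ-≢ {pair j c} (λ eq → <-irrefl (proj₁ (pair-injective {j} {c} {i} {c} eq)) j<i))

unpairAt-none : ∀ c N → (∀ i → pair i c ≢ N) → unpairAt c N ≡ 0
unpairAt-none c N not-pair = firstNonzero-none _ N λ i _ → cong (_* suc i) (eqᴺ-≢ (not-pair i))

nameBit : Cantor → ℕ → ℕ → Bool
nameBit q (suc i) _       = not (q i)
nameBit q zero    zero    = false
nameBit q zero    (suc _) = true

-- The first 1 of the i-th subsequence of toName q is at index 0 if q i is false and at index 1 otherwise.
toName : Cantor → Cantor
toName q N = nameBit q (unpairAt 0 N) (unpairAt 1 N)

toName-pair-0 : ∀ q i → toName q (pair i 0) ≡ not (q i)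
toName-pair-0 q i rewrite unpairAt-pair 0 i = refl

toName-pair-1 : ∀ q i → toName q (pair i 1) ≡ true
toName-pair-1 q i rewrite unpairAt-none 0 (pair i 1) (λ i' eq → 0≢1+n (proj₂ (pair-injective {i'} {0} {i} {1} eq)))
                        | unpairAt-pair 1 i = refl

toName-names : ∀ q → δTω (toName q) (λ i → ι (q i))
toName-names q i with q i in qi
... | false = 0 , (trans (toName-pair-0 q i) (cong not qi) , λ _ ()) , refl
... | true  = 1 , (toName-pair-1 q i , λ { zero _ → trans (toName-pair-0 q i) (cong not qi) ; (suc _) (s≤s ()) }) , refl

v0 : ∀ {k n} → Exp k (suc n)
v0 = var zero

v1 : ∀ {k n} → Exp k (suc (suc n))
v1 = var (suc zero)

v2 : ∀ {k n} → Exp k (suc (suc (suc n)))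
v2 = var (suc (suc zero))

v3 : ∀ {k n} → Exp k (suc (suc (suc (suc n))))
v3 = var (suc (suc (suc zero)))

litE : ∀ {k n} → ℕ → Exp k n
litE zero    = zer
litE (suc c) = sc (litE c)

idV : ∀ {k n} → Vec (Exp k n) n
idV = tabulate var

-- In the step of rec, v0 is the counter and v1 the previous value; shiftV reaches the enclosing context.
shiftV : ∀ {k n} → Vec (Exp k (suc (suc n))) n
shiftV = tabulate (λ i → var (suc (suc i)))

mod2E div2E pow2E tailE : ∀ {k n} → Exp k n → Exp k n
mod2E   = rec zer (litE 1 ⊝ v1)
div2E   = rec zer (v1 ⊕ mod2E v0)
pow2E   = rec (litE 1) (litE 2 ⊗ v1)
tailE x = div2E (x ⊝ litE 1)

ltE eqE pairE dropE digitE : ∀ {k n} → Exp k n → Exp k n → Exp k n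
ltE a b    = ifzE (b ⊝ a) zer (litE 1)
eqE a b    = ifzE ((a ⊝ b) ⊕ (b ⊝ a)) (litE 1) zer
pairE i j  = pow2E i ⊗ (litE 2 ⊗ j ⊕ litE 1) ⊝ litE 1
dropE j x  = rec x (tailE v1) j
digitE j x = ifzE (dropE j x) zer (sc (mod2E (dropE j x ⊝ litE 1)))

μE firstNonzeroE digitsE allPositiveE : ∀ {k n} → Exp k (suc n) → Exp k n → Exp k n
μE P b              = rec zer (ifzE (ltE v1 v0) (ifzE (app P (v0 ∷ shiftV)) (sc v0) v0) v1) b
firstNonzeroE h b   = ifzE (ltE (μE h (sc b)) (sc b)) zer (app h (μE h (sc b) ∷ idV))
digitsE d j         = rec zer (v1 ⊕ app d (v0 ∷ shiftV) ⊗ pow2E v0) j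
allPositiveE d j    = rec (litE 1) (v1 ⊗ ifzE (app d (v0 ∷ shiftV)) zer (litE 1)) j

unpairE : ∀ {k n} → ℕ → Exp k (suc n)
unpairE c = firstNonzeroE (eqE (pairE v0 (litE c)) v1 ⊗ sc v0) v0

clampE : ∀ {k n} → Exp k n → Exp k n
clampE a = ifzE a zer (ifzE (a ⊝ litE 1) (litE 1) (ifzE (a ⊝ litE 2) (litE 2) zer))

module SemanticsLemmas {k} (O : Fin k → ℕ → ℕ → ℕ) where
  open Semantics O

  ⟦tabulate-var⟧ : ∀ {n m} (xs : Vec ℕ n) (ρ : Fin m → Fin n) →
    ⟦ tabulate (λ i → var (ρ i)) ⟧* xs ≡ tabulate (λ i → lookup xs (ρ i))
  ⟦tabulate-var⟧ {m = zero}  xs ρ = refl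
  ⟦tabulate-var⟧ {m = suc m} xs ρ = cong (lookup xs (ρ zero) ∷_) (⟦tabulate-var⟧ xs (λ i → ρ (suc i)))

  ⟦idV⟧ : ∀ {n} (xs : Vec ℕ n) → ⟦ idV ⟧* xs ≡ xs
  ⟦idV⟧ xs = trans (⟦tabulate-var⟧ xs (λ i → i)) (tabulate∘lookup xs)

  ⟦shiftV⟧ : ∀ {n} a b (xs : Vec ℕ n) → ⟦ shiftV ⟧* (a ∷ b ∷ xs) ≡ xs
  ⟦shiftV⟧ a b xs = trans (⟦tabulate-var⟧ (a ∷ b ∷ xs) (λ i → suc (suc i))) (tabulate∘lookup xs)

  ⟦litE⟧ : ∀ {n} c (xs : Vec ℕ n) → ⟦ litE c ⟧ xs ≡ c
  ⟦litE⟧ zero    xs = refl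
  ⟦litE⟧ (suc c) xs = cong suc (⟦litE⟧ c xs)

  ⟦mod2E⟧ : ∀ {n} (a : Exp k n) xs → ⟦ mod2E a ⟧ xs ≡ mod2 (⟦ a ⟧ xs)
  ⟦mod2E⟧ a xs = go (⟦ a ⟧ xs)
    where go : ∀ j → iterate zer (litE 1 ⊝ v1) xs j ≡ mod2 j
          go zero    = refl
          go (suc j) = cong (1 ∸_) (go j)

  ⟦div2E⟧ : ∀ {n} (a : Exp k n) xs → ⟦ div2E a ⟧ xs ≡ div2 (⟦ a ⟧ xs)
  ⟦div2E⟧ a xs = go (⟦ a ⟧ xs)
    where go : ∀ j → iterate zer (v1 ⊕ mod2E v0) xs j ≡ div2 j
          go zero    = refl
          go (suc j) = cong₂ _+_ (go j) (⟦mod2E⟧ v0 (j ∷ iterate zer (v1 ⊕ mod2E v0) xs j ∷ xs))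

  ⟦pow2E⟧ : ∀ {n} (a : Exp k n) xs → ⟦ pow2E a ⟧ xs ≡ 2 ^ ⟦ a ⟧ xs
  ⟦pow2E⟧ a xs = go (⟦ a ⟧ xs)
    where go : ∀ j → iterate (litE 1) (litE 2 ⊗ v1) xs j ≡ 2 ^ j
          go zero    = refl
          go (suc j) = cong (2 *_) (go j)

  ⟦pairE⟧ : ∀ {n} (a b : Exp k n) xs → ⟦ pairE a b ⟧ xs ≡ pair (⟦ a ⟧ xs) (⟦ b ⟧ xs)
  ⟦pairE⟧ a b xs = cong (λ t → t * (2 * ⟦ b ⟧ xs + 1) ∸ 1) (⟦pow2E⟧ a xs)

  ⟦dropE⟧ : ∀ {n} (a x : Exp k n) xs → ⟦ dropE a x ⟧ xs ≡ dropCode (⟦ a ⟧ xs) (⟦ x ⟧ xs)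
  ⟦dropE⟧ a x xs = go (⟦ a ⟧ xs)
    where go : ∀ j → iterate x (tailE v1) xs j ≡ dropCode j (⟦ x ⟧ xs)
          go zero    = refl
          go (suc j) = trans (⟦div2E⟧ (v1 ⊝ litE 1) (j ∷ iterate x (tailE v1) xs j ∷ xs))
                             (cong (λ r → div2 (r ∸ 1)) (go j))

  ⟦digitE⟧ : ∀ {n} (a x : Exp k n) xs → ⟦ digitE a x ⟧ xs ≡ digit (⟦ a ⟧ xs) (⟦ x ⟧ xs)
  ⟦digitE⟧ a x xs =
    trans (cong (λ m → ifz (⟦ dropE a x ⟧ xs) 0 (suc m)) (⟦mod2E⟧ (dropE a x ⊝ litE 1) xs))
          (cong (λ t → ifz t 0 (suc (mod2 (t ∸ 1)))) (⟦dropE⟧ a x xs))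

  ⟦μE⟧ : ∀ {n} (P : Exp k (suc n)) b xs → ⟦ μE P b ⟧ xs ≡ μ< (λ z → ⟦ P ⟧ (z ∷ xs)) (⟦ b ⟧ xs)
  ⟦μE⟧ P b xs = go (⟦ b ⟧ xs)
    where
      step = ifzE (ltE v1 v0) (ifzE (app P (v0 ∷ shiftV)) (sc v0) v0) v1
      go : ∀ j → iterate zer step xs j ≡ μ< (λ z → ⟦ P ⟧ (z ∷ xs)) j
      go zero    = refl
      go (suc j) rewrite ⟦shiftV⟧ j (iterate zer step xs j) xs | go j = refl

  ⟦firstNonzeroE⟧ : ∀ {n} (h : Exp k (suc n)) b xs →
    ⟦ firstNonzeroE h b ⟧ xs ≡ firstNonzero (λ z → ⟦ h ⟧ (z ∷ xs)) (⟦ b ⟧ xs)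
  ⟦firstNonzeroE⟧ h b xs rewrite ⟦μE⟧ h (sc b) xs | ⟦idV⟧ xs = refl

  ⟦digitsE⟧ : ∀ {n} (d : Exp k (suc n)) a xs →
    ⟦ digitsE d a ⟧ xs ≡ digitsCode (λ z → ⟦ d ⟧ (z ∷ xs)) (⟦ a ⟧ xs)
  ⟦digitsE⟧ d a xs = go (⟦ a ⟧ xs)
    where
      step = v1 ⊕ app d (v0 ∷ shiftV) ⊗ pow2E v0
      go : ∀ j → iterate zer step xs j ≡ digitsCode (λ z → ⟦ d ⟧ (z ∷ xs)) j
      go zero    = refl
      go (suc j) rewrite ⟦shiftV⟧ j (iterate zer step xs j) xs | ⟦pow2E⟧ v0 (j ∷ iterate zer step xs j ∷ xs)
                       | go j = refl

  ⟦allPositiveE⟧ : ∀ {n} (d : Exp k (suc n)) a xs →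
    ⟦ allPositiveE d a ⟧ xs ≡ allPositive (λ z → ⟦ d ⟧ (z ∷ xs)) (⟦ a ⟧ xs)
  ⟦allPositiveE⟧ d a xs = go (⟦ a ⟧ xs)
    where
      step = v1 ⊗ ifzE (app d (v0 ∷ shiftV)) zer (litE 1)
      go : ∀ j → iterate (litE 1) step xs j ≡ allPositive (λ z → ⟦ d ⟧ (z ∷ xs)) j
      go zero    = refl
      go (suc j) rewrite ⟦shiftV⟧ j (iterate (litE 1) step xs j) xs | go j = refl

  ⟦unpairE⟧ : ∀ {n} c N (xs : Vec ℕ n) → ⟦ unpairE c ⟧ (N ∷ xs) ≡ unpairAt c N
  ⟦unpairE⟧ c N xs = trans (⟦firstNonzeroE⟧ _ v0 (N ∷ xs))
    (firstNonzero-cong _ _ N (λ i → cong (λ t → eqᴺ t N * suc i)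
      (trans (⟦pairE⟧ v0 (litE c) (i ∷ N ∷ xs)) (cong (pair i) (⟦litE⟧ c (i ∷ N ∷ xs))))))

  ⟦clampE⟧ : ∀ {n} (a : Exp k n) xs → ⟦ clampE a ⟧ xs ≡ encodeM (decodeM (⟦ a ⟧ xs))
  ⟦clampE⟧ a xs with ⟦ a ⟧ xs
  ... | 0                   = refl
  ... | 1                   = refl
  ... | 2                   = refl
  ... | suc (suc (suc _))   = refl

outputs-from : ∀ (m : Machine) p q →
  (∀ n k → m n (prefix p k) ≡ nothing ⊎ m n (prefix p k) ≡ just (q n)) →
  (∀ n → Σ ℕ λ K → m n (prefix p K) ≡ just (q n)) → Outputs m p q
outputs-from m p q never-wrong eventually n = K₀ , answer , λ j j<K₀ → encodeM-≡0 (proj₂ first j j<K₀)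
  where
    K = proj₁ (eventually n)
    f : ℕ → ℕ
    f k = encodeM (m n (prefix p k))
    K₀ = μ< f (suc K)
    first : FirstNonzero f K₀
    first = μ<-first f (suc K)
      (μ<-found f (λ fK≡0 → encodeM-just≢0 (q n) (trans (cong encodeM (sym (proj₂ (eventually n)))) fK≡0)) ≤-refl)
    answer : m n (prefix p K₀) ≡ just (q n)
    answer with never-wrong n K₀
    ... | inj₁ none = ⊥-elim (proj₁ first (cong encodeM none))
    ... | inj₂ qn   = qn

oracle : Machine → ℕ → ℕ → ℕ
oracle M n x = encodeM (M n (decodeW x))

oracle-encodeW : ∀ M n w → oracle M n (encodeW w) ≡ encodeM (M n w)
oracle-encodeW M n w = cong (λ u → encodeM (M n u)) (decodeW-encodeW w)

oracle-code : ∀ M → ComputableMachine M → Σ (PR 2) λ c → ∀ n x → Eval c (n ∷ x ∷ []) (oracle M n x)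
oracle-code M (c , eval-c) =
  c , λ n x → subst (λ y → Eval c (n ∷ y ∷ []) (oracle M n x)) (encodeW-decodeW x) (eval-c n (decodeW x))

oracles : ∀ {k} → (Fin k → Machine) → Fin k → ℕ → ℕ → ℕ
oracles Ms i = oracle (Ms i)

answer : ∀ {k} → Exp k 2 → (Fin k → Machine) → ℕ → ℕ → ℕ
answer e Ms n x = Semantics.⟦_⟧ (oracles Ms) e (n ∷ x ∷ [])

run : ∀ {k} → Exp k 2 → (Fin k → Machine) → Machine
run e Ms n w = decodeM (answer e Ms n (encodeW w))

run-admissible : ∀ mode {k} (e : Exp k 2) Ms → (∀ i → Admissible mode (Ms i)) → Admissible mode (run e Ms)
run-admissible computable e Ms computable-Ms =
  compile (clampE e) , λ n w → subst (Eval (compile (clampE e)) (n ∷ encodeW w ∷ []))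
    (⟦clampE⟧ e (n ∷ encodeW w ∷ [])) (eval-compile (clampE e) (n ∷ encodeW w ∷ []))
  where
    O = oracles Ms
    open Compile O (λ i → proj₁ (oracle-code (Ms i) (computable-Ms i)))
                   (λ i → proj₂ (oracle-code (Ms i) (computable-Ms i)))
    open SemanticsLemmas O
run-admissible continuous e Ms _ = tt

run-outputs : ∀ {k} (e : Exp k 2) Ms p q →
  (∀ n L → answer e Ms n (encodeW (prefix p L)) ≡ 0 ⊎ answer e Ms n (encodeW (prefix p L)) ≡ encodeM (just (q n))) →
  (∀ n → Σ ℕ λ L → answer e Ms n (encodeW (prefix p L)) ≡ encodeM (just (q n))) →
  Outputs (run e Ms) p q
run-outputs e Ms p q never-wrong eventually = outputs-from (run e Ms) p q
  (λ n L → ⊎-map (cong decodeM) (λ v → trans (cong decodeM v) (decodeM-encodeM (q n))) (never-wrong n L))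
  (λ n → proj₁ (eventually n) , trans (cong decodeM (proj₂ (eventually n))) (decodeM-encodeM (q n)))

firstNonzero-stage : ∀ h g B {k₀ b} → FirstStage g k₀ b →
  (∀ K → FirstNonzero h K → ∀ j → j ≤ K → h j ≡ encodeM (g j)) →
  firstNonzero h B ≡ 0 ⊎ firstNonzero h B ≡ encodeM (just b)
firstNonzero-stage h g B stage agree with firstNonzero-cases h B
... | inj₁ none = inj₁ none
... | inj₂ (K , _ , first@(hK≢0 , zeros) , value)
  with encodeM-≢0 (g K) (λ gK≡0 → hK≢0 (trans (agree K first K ≤-refl) gK≡0))
...   | b' , gK = inj₂ (trans value (trans (agree K first K ≤-refl)
          (cong encodeM (trans gK (cong just (FirstStage-unique stage' stage))))))
  where stage' = gK , λ j j<K → encodeM-≡0 (trans (sym (agree K first j (<⇒≤ j<K))) (zeros j j<K))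

firstNonzero-stage-hit : ∀ h g {B k₀ b} → FirstStage g k₀ b → k₀ ≤ B →
  (∀ j → j ≤ k₀ → h j ≡ encodeM (g j)) → firstNonzero h B ≡ encodeM (just b)
firstNonzero-stage-hit h g {b = b} (gk₀ , below) k₀≤B agree =
  trans (firstNonzero-hit h (hk₀≢0 , λ j j<k₀ → trans (agree j (<⇒≤ j<k₀)) (cong encodeM (below j j<k₀))) k₀≤B)
        (trans (agree _ ≤-refl) (cong encodeM gk₀))
  where hk₀≢0 = λ hk₀≡0 →
          encodeM-just≢0 b (trans (cong encodeM (sym gk₀)) (trans (sym (agree _ ≤-refl)) hk₀≡0))

noMachines : Fin 0 → Machine
noMachines ()

module Sem₀ = SemanticsLemmas (oracles noMachines)

-- At position i on the code x of a prefix: 1 + the parity of the first j with a 1 at pair i j inside the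
-- prefix, since digit (pair i j) x ∸ 1 is that letter inside the prefix and 0 beyond it.
decodeE : Exp 0 2
decodeE = firstNonzeroE ((digitE (pairE v1 v0) v2 ⊝ litE 1) ⊗ sc (mod2E v0)) v1

decodeMachine : Machine
decodeMachine = run decodeE noMachines

marked : ℕ → ℕ → ℕ → ℕ
marked x i j = (digit (pair i j) x ∸ 1) * suc (mod2 j)

decode-answer : ∀ i x → answer decodeE noMachines i x ≡ firstNonzero (marked x i) x
decode-answer i x = trans (Sem₀.⟦firstNonzeroE⟧ _ v1 (i ∷ x ∷ []))
  (firstNonzero-cong _ _ x λ j → cong₂ (λ d m → (d ∸ 1) * suc m)
    (trans (Sem₀.⟦digitE⟧ (pairE v1 v0) v2 (j ∷ i ∷ x ∷ []))
           (cong (λ N → digit N x) (Sem₀.⟦pairE⟧ v1 v0 (j ∷ i ∷ x ∷ []))))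
    (Sem₀.⟦mod2E⟧ v0 (j ∷ i ∷ x ∷ [])))

module _ (p : Cantor) (L i : ℕ) where
  private x = encodeW (prefix p L)

  marked-inside : ∀ j → pair i j < L → marked x i j ≡ bit (p (pair i j)) * suc (mod2 j)
  marked-inside j inside = cong (λ d → (d ∸ 1) * suc (mod2 j)) (digit-prefix-< p inside)

  marked-≢0 : ∀ j → marked x i j ≢ 0 → pair i j < L × p (pair i j) ≡ true
  marked-≢0 j ≢0 with pair i j <? L
  ... | no outside = ⊥-elim (≢0 (cong (λ d → (d ∸ 1) * suc (mod2 j)) (digit-prefix-≥ p (≮⇒≥ outside))))
  ... | yes inside with p (pair i j) in pij
  ...   | true  = inside , refl
  ...   | false = ⊥-elim (≢0 (trans (marked-inside j inside) (cong (λ b → bit b * suc (mod2 j)) pij)))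

  marked-first : ∀ K → FirstNonzero (marked x i) K → FirstOne (λ j → p (pair i j)) K × pair i K < L
  marked-first K (≢0 , zeros) with marked-≢0 K ≢0
  ... | inside , one = (one , zero-before) , inside
    where
      zero-before : ∀ j → j < K → p (pair i j) ≡ false
      zero-before j j<K with p (pair i j) in pij
      ... | false = refl
      ... | true  = ⊥-elim (0≢1+n (trans (sym (zeros j j<K))
                      (trans (marked-inside j (<-trans (pair-monoʳ-< i j<K) inside))
                             (cong (λ b → bit b * suc (mod2 j)) pij))))

  marked-at-first-one : ∀ {n b} → FirstOne (λ j → p (pair i j)) n → suc (mod2 n) ≡ encodeM (just b) →
    pair i n < L → marked x i n ≡ encodeM (just b)
  marked-at-first-one {n} (one , _) parity inside =
    trans (marked-inside n inside) (trans (cong (λ b → bit b * suc (mod2 n)) one) (trans (+-identityʳ _) parity))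

decode-outputs : ∀ p q → δTω p (λ i → ι (q i)) → Outputs decodeMachine p q
decode-outputs p q names = run-outputs decodeE noMachines p q never-wrong eventually
  where
    never-wrong : ∀ i L → answer decodeE noMachines i (encodeW (prefix p L)) ≡ 0 ⊎
                          answer decodeE noMachines i (encodeW (prefix p L)) ≡ encodeM (just (q i))
    never-wrong i L rewrite decode-answer i (encodeW (prefix p L))
      with firstNonzero-cases (marked (encodeW (prefix p L)) i) (encodeW (prefix p L))
    ... | inj₁ none = inj₁ none
    ... | inj₂ (K , _ , first , v) with δ𝕋-ι (names i) | marked-first p L i K first
    ...   | n , first-one , parity | first-one' , inside rewrite FirstOne-unique first-one' first-one =
      inj₂ (trans v (marked-at-first-one p L i first-one parity inside))

    eventually : ∀ i → Σ ℕ λ L → answer decodeE noMachines i (encodeW (prefix p L)) ≡ encodeM (just (q i))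
    eventually i with δ𝕋-ι (names i)
    ... | n , first-one@(_ , zero-before) , parity = L , trans (decode-answer i x)
      (trans (firstNonzero-hit (marked x i) (value≢0 , unmarked) n≤x) value)
      where
        L = suc (pair i n)
        x = encodeW (prefix p L)
        value = marked-at-first-one p L i first-one parity ≤-refl
        value≢0 = λ ≡0 → encodeM-just≢0 (q i) (trans (sym value) ≡0)
        unmarked : ∀ j → j < n → marked x i j ≡ 0
        unmarked j j<n = trans (marked-inside p L i j (<-trans (pair-monoʳ-< i j<n) (n<1+n _)))
                               (cong (λ b → bit b * suc (mod2 j)) (zero-before j j<n))
        n≤x = ≤-trans (j≤pair i n) (≤-trans (n≤1+n _) (prefix-length≤encodeW p L))

flipE : ∀ {k n} → Exp k n → Exp k n
flipE d = ifzE d zer (litE 3 ⊝ d)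

-- Position pair i 0 waits until q i is inside the prefix; every other position is answered at once.
encodeE : Exp 0 2
encodeE = ifzE (unpairE 0) (ifzE (unpairE 1) (litE 1) (litE 2)) (flipE (digitE (unpairE 0 ⊝ litE 1) v1))

encodeMachine : Machine
encodeMachine = run encodeE noMachines

flip : ℕ → ℕ
flip d = ifz d 0 (3 ∸ d)

nameAnswer : ℕ → ℕ → ℕ → ℕ
nameAnswer u₀ u₁ x = ifz u₀ (ifz u₁ 1 2) (flip (digit (u₀ ∸ 1) x))

encode-answer : ∀ N x → answer encodeE noMachines N x ≡ nameAnswer (unpairAt 0 N) (unpairAt 1 N) x
encode-answer N x
  rewrite Sem₀.⟦digitE⟧ (unpairE 0 ⊝ litE 1) v1 (N ∷ x ∷ [])
        | Sem₀.⟦unpairE⟧ 0 N (x ∷ []) | Sem₀.⟦unpairE⟧ 1 N (x ∷ []) = refl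

flip-digit : ∀ b → flip (suc (bit b)) ≡ encodeM (just (not b))
flip-digit false = refl
flip-digit true  = refl

nameAnswer-cases : ∀ q L u₀ u₁ → nameAnswer u₀ u₁ (encodeW (prefix q L)) ≡ 0 ⊎
                                 nameAnswer u₀ u₁ (encodeW (prefix q L)) ≡ encodeM (just (nameBit q u₀ u₁))
nameAnswer-cases q L zero    zero    = inj₂ refl
nameAnswer-cases q L zero    (suc _) = inj₂ refl
nameAnswer-cases q L (suc i) _ with i <? L
... | yes inside  = inj₂ (trans (cong flip (digit-prefix-< q inside)) (flip-digit (q i)))
... | no  outside = inj₁ (cong flip (digit-prefix-≥ q (≮⇒≥ outside)))

nameAnswer-late : ∀ q u₀ u₁ → nameAnswer u₀ u₁ (encodeW (prefix q u₀)) ≡ encodeM (just (nameBit q u₀ u₁))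
nameAnswer-late q zero    zero    = refl
nameAnswer-late q zero    (suc _) = refl
nameAnswer-late q (suc i) _       = trans (cong flip (digit-prefix-< q ≤-refl)) (flip-digit (q i))

encode-outputs : ∀ q → Outputs encodeMachine q (toName q)
encode-outputs q = run-outputs encodeE noMachines q (toName q)
  (λ N L → subst (λ a → a ≡ 0 ⊎ a ≡ encodeM (just (toName q N))) (sym (encode-answer N _))
                 (nameAnswer-cases q L (unpairAt 0 N) (unpairAt 1 N)))
  (λ N → unpairAt 0 N , trans (encode-answer N _) (nameAnswer-late q (unpairAt 0 N) (unpairAt 1 N)))

digitsCode-cong : ∀ d d' k → (∀ z → d z ≡ d' z) → digitsCode d k ≡ digitsCode d' k
digitsCode-cong d d' zero    d≗d' = refl
digitsCode-cong d d' (suc k) d≗d' = cong₂ (λ c e → c + e * 2 ^ k) (digitsCode-cong d d' k d≗d') (d≗d' k)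

allPositive-cong : ∀ d d' k → (∀ z → d z ≡ d' z) → allPositive d k ≡ allPositive d' k
allPositive-cong d d' zero    d≗d' = refl
allPositive-cong d d' (suc k) d≗d' = cong₂ (λ c e → c * ifz e 0 1) (allPositive-cong d d' k d≗d') (d≗d' k)

takeE : ∀ {k} → Exp k 2
takeE = digitsE (digitE v0 v2) v0

-- At position m: the answer of the first oracle at the first stage k ≤ x at which it answers, on the
-- prefix of length k of the word with code x.
stageE : Exp 2 2
stageE = firstNonzeroE (call zero v1 (app takeE (v0 ∷ v2 ∷ []))) v1

-- At position n: the answer of the second oracle at the first stage j ≤ x at which it answers, on the
-- first j output digits of the first oracle, provided all of them are known.
composeE : Exp 2 2
composeE = firstNonzeroE (allPositiveE stages v0 ⊗ call (suc zero) v1 (digitsE stages v0)) v1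
  where stages : Exp 2 4
        stages = app stageE (v0 ∷ v3 ∷ [])

compose : Machine → Machine → Machine
compose A B = run composeE (lookup (A ∷ B ∷ []))

stageAnswer : (ℕ → ℕ → ℕ) → ℕ → ℕ → ℕ
stageAnswer O m x = firstNonzero (λ k → O m (takeCode k x)) x

composeAnswer : (ℕ → ℕ → ℕ) → (ℕ → ℕ → ℕ) → ℕ → ℕ → ℕ
composeAnswer O₁ O₂ n x =
  firstNonzero (λ j → allPositive stages j * O₂ n (digitsCode stages j)) x
  where stages = λ m → stageAnswer O₁ m x

compose-answer : ∀ A B n x → answer composeE (lookup (A ∷ B ∷ [])) n x ≡ composeAnswer (oracle A) (oracle B) n x
compose-answer A B n x = trans (⟦firstNonzeroE⟧ _ v1 (n ∷ x ∷ []))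
  (firstNonzero-cong _ _ x λ j → cong₂ (λ c v → c * oracle B n v)
    (trans (⟦allPositiveE⟧ _ v0 (j ∷ n ∷ x ∷ [])) (allPositive-cong _ _ j (λ m → ⟦stageE⟧ m x)))
    (trans (⟦digitsE⟧ _ v0 (j ∷ n ∷ x ∷ [])) (digitsCode-cong _ _ j (λ m → ⟦stageE⟧ m x))))
  where
    open SemanticsLemmas (oracles (lookup (A ∷ B ∷ [])))
    open Semantics (oracles (lookup (A ∷ B ∷ [])))
    ⟦takeE⟧ : ∀ k x → ⟦ takeE ⟧ (k ∷ x ∷ []) ≡ takeCode k x
    ⟦takeE⟧ k x = trans (⟦digitsE⟧ _ v0 (k ∷ x ∷ []))
                        (digitsCode-cong _ _ k (λ j → ⟦digitE⟧ v0 v2 (j ∷ k ∷ x ∷ [])))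
    ⟦stageE⟧ : ∀ m x → ⟦ stageE ⟧ (m ∷ x ∷ []) ≡ stageAnswer (oracle A) m x
    ⟦stageE⟧ m x = trans (⟦firstNonzeroE⟧ _ v1 (m ∷ x ∷ []))
      (firstNonzero-cong _ _ x (λ k → cong (oracle A m) (⟦takeE⟧ k x)))

module _ (A B : Machine) (p q r : Cantor) (outA : Outputs A p q) (outB : Outputs B q r) (L : ℕ) where
  private
    x = encodeW (prefix p L)
    stages = λ m → stageAnswer (oracle A) m x

  oracle-takeCode : ∀ m k → oracle A m (takeCode k x) ≡ encodeM (A m (prefix p (k ⊓ L)))
  oracle-takeCode m k = trans (cong (oracle A m) (takeCode-prefix p L k)) (oracle-encodeW A m (prefix p (k ⊓ L)))

  private
    within : ∀ m {j} → j ≤ L → oracle A m (takeCode j x) ≡ encodeM (A m (prefix p j))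
    within m j≤L = trans (oracle-takeCode m _) (cong (λ t → encodeM (A m (prefix p t))) (m≤n⇒m⊓n≡m j≤L))

    -- Beyond L the stages repeat the one at L, so a first answering stage lies within L.
    first-within : ∀ m K → FirstNonzero (λ k → oracle A m (takeCode k x)) K → K ≤ L
    first-within m K (≢0 , zeros) with K ≤? L
    ... | yes K≤L = K≤L
    ... | no  K≰L = ⊥-elim (≢0 (begin
      oracle A m (takeCode K x)                ≡⟨ oracle-takeCode m K ⟩
      encodeM (A m (prefix p (K ⊓ L)))        ≡⟨ cong (λ t → encodeM (A m (prefix p t))) (m≥n⇒m⊓n≡n L≤K) ⟩
      encodeM (A m (prefix p L))              ≡⟨ sym (within m ≤-refl) ⟩
      oracle A m (takeCode L x)                ≡⟨ zeros L (≰⇒> K≰L) ⟩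
      0                                        ∎))
      where open ≡-Reasoning
            L≤K = <⇒≤ (≰⇒> K≰L)

  stage-cases : ∀ m → stages m ≡ 0 ⊎ stages m ≡ encodeM (just (q m))
  stage-cases m = firstNonzero-stage _ (λ k → A m (prefix p k)) x (proj₂ (outA m))
    (λ K first j j≤K → within m (≤-trans j≤K (first-within m K first)))

  stage-hit : ∀ m → proj₁ (outA m) ≤ L → stages m ≡ encodeM (just (q m))
  stage-hit m kA≤L = firstNonzero-stage-hit _ (λ k → A m (prefix p k)) (proj₂ (outA m))
    (≤-trans kA≤L (prefix-length≤encodeW p L)) (λ j j≤kA → within m (≤-trans j≤kA kA≤L))

  private
    known-digits : ∀ j → (∀ m → m < j → stages m ≢ 0) → digitsCode stages j ≡ encodeW (prefix q j)
    known-digits j known = digitsCode-prefix stages q j λ m m<j → known-digit m (known m m<j)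
      where known-digit : ∀ m → stages m ≢ 0 → stages m ≡ suc (bit (q m))
            known-digit m ≢0 with stage-cases m
            ... | inj₁ ≡0 = ⊥-elim (≢0 ≡0)
            ... | inj₂ v  = trans v (encodeM-just (q m))

    known-answer : ∀ n j → (∀ m → m < j → stages m ≢ 0) →
      allPositive stages j * oracle B n (digitsCode stages j) ≡ encodeM (B n (prefix q j))
    known-answer n j known = begin
      allPositive stages j * oracle B n (digitsCode stages j)
        ≡⟨ cong₂ (λ c v → c * oracle B n v) (allPositive-≡1 stages j known) (known-digits j known) ⟩
      1 * oracle B n (encodeW (prefix q j))   ≡⟨ *-identityˡ _ ⟩
      oracle B n (encodeW (prefix q j))       ≡⟨ oracle-encodeW B n (prefix q j) ⟩
      encodeM (B n (prefix q j))              ∎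
      where open ≡-Reasoning

  compose-cases : ∀ n → composeAnswer (oracle A) (oracle B) n x ≡ 0 ⊎
                        composeAnswer (oracle A) (oracle B) n x ≡ encodeM (just (r n))
  compose-cases n = firstNonzero-stage _ (λ j → B n (prefix q j)) x (proj₂ (outB n))
    λ K (≢0 , _) j j≤K → known-answer n j λ m m<j →
      allPositive-≢0 stages K (λ all≡0 → ≢0 (cong (_* oracle B n (digitsCode stages K)) all≡0))
                     m (<-≤-trans m<j j≤K)

  compose-hit : ∀ n → proj₁ (outB n) ≤ L → (∀ m → m < proj₁ (outB n) → proj₁ (outA m) ≤ L) →
    composeAnswer (oracle A) (oracle B) n x ≡ encodeM (just (r n))
  compose-hit n kB≤L kA≤L = firstNonzero-stage-hit _ (λ j → B n (prefix q j)) (proj₂ (outB n))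
    (≤-trans kB≤L (prefix-length≤encodeW p L))
    λ j j≤kB → known-answer n j λ m m<j stage≡0 →
      encodeM-just≢0 (q m) (trans (sym (stage-hit m (kA≤L m (<-≤-trans m<j j≤kB)))) stage≡0)

bound : (f : ℕ → ℕ) (n : ℕ) → Σ ℕ λ B → ∀ m → m < n → f m ≤ B
bound f zero    = 0 , λ _ ()
bound f (suc n) = proj₁ (bound f n) ⊔ f n , below
  where
    below : ∀ m → m < suc n → f m ≤ proj₁ (bound f n) ⊔ f n
    below m m<1+n with m≤n⇒m<n∨m≡n (≤-pred m<1+n)
    ... | inj₁ m<n  = ≤-trans (proj₂ (bound f n) m m<n) (m≤m⊔n _ (f n))
    ... | inj₂ refl = m≤n⊔m (proj₁ (bound f n)) (f m)

compose-outputs : ∀ A B p q r → Outputs A p q → Outputs B q r → Outputs (compose A B) p r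
compose-outputs A B p q r outA outB = run-outputs composeE (lookup (A ∷ B ∷ [])) p r
  (λ n L → subst (λ a → a ≡ 0 ⊎ a ≡ encodeM (just (r n))) (sym (compose-answer A B n (encodeW (prefix p L))))
                 (compose-cases A B p q r outA outB L n))
  λ n → let kB = proj₁ (outB n)
            kA = proj₁ (bound (λ m → proj₁ (outA m)) kB)
        in kB ⊔ kA , trans (compose-answer A B n (encodeW (prefix p (kB ⊔ kA))))
             (compose-hit A B p q r outA outB (kB ⊔ kA) n (m≤m⊔n kB kA)
               (λ m m<kB → ≤-trans (proj₂ (bound (λ m → proj₁ (outA m)) kB) m m<kB) (m≤n⊔m kB kA)))

compose-admissible : ∀ mode A B → Admissible mode A → Admissible mode B → Admissible mode (compose A B)
compose-admissible mode A B admA admB = run-admissible mode composeE (lookup (A ∷ B ∷ []))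
  λ { zero → admA ; (suc zero) → admB }

decode-admissible : ∀ mode → Admissible mode decodeMachine
decode-admissible mode = run-admissible mode decodeE noMachines (λ ())

encode-admissible : ∀ mode → Admissible mode encodeMachine
encode-admissible mode = run-admissible mode encodeE noMachines (λ ())

SingleValued : {X : Set} → (Tω → X → Set) → Set
SingleValued {X} ψ = ∀ {t x x'} → ψ t x → ψ t x' → x ≡ x'

Surjective : {X : Set} → (Tω → X → Set) → Set
Surjective {X} ψ = ∀ x → Σ Tω λ t → ψ t x

ι-injective : ∀ {a b} → ι a ≡ ι b → a ≡ b
ι-injective {false} {false} _ = refl
ι-injective {true}  {true}  _ = refl
ι-injective {false} {true}  ()
ι-injective {true}  {false} ()

asTRep-single-valued : ∀ {X} {δ : Cantor → X → Set} → IsRepresentation δ → SingleValued (asTRep δ)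
asTRep-single-valued (single-valued , _) (p , tp , δp) (p' , tp' , δp') =
  single-valued p p' _ _ (λ n → ι-injective (trans (sym (tp n)) (tp' n))) δp δp'

asTRep-surjective : ∀ {X} {δ : Cantor → X → Set} → IsRepresentation δ → Surjective (asTRep δ)
asTRep-surjective (_ , _ , surjective) x with surjective x
... | p , δp = (λ n → ι (p n)) , p , (λ n → refl) , δp

record Realized {X Y : Set} (ψX : Tω → X → Set) (ψY : Tω → Y → Set) (f : X → Y → Set) (t t' : Tω) : Set where
  constructor realized
  field
    in-domain : Σ X λ x → ψX t x × Σ Y (f x)
    sound     : ∀ x → ψX t x → Σ Y λ y → ψY t' y × f x y

realized-intro : ∀ {X Y} {ψX : Tω → X → Set} (ψY : Tω → Y → Set) (f : X → Y → Set) → SingleValued ψX →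
  ∀ {t t' x y} → ψX t x → ψY t' y → f x y → Realized ψX ψY f t t'
realized-intro ψY f single-valued {y = y} ψx ψy fxy =
  realized (_ , ψx , y , fxy) λ x' ψx' → y , ψy , subst (λ z → f z y) (single-valued ψx ψx') fxy

realized-realizer : ∀ {X Y} (ψX : Tω → X → Set) (ψY : Tω → Y → Set) f → SingleValued ψX → Surjective ψY →
  TRealizer ψX ψY f (Realized ψX ψY f)
realized-realizer ψX ψY f single-valued surjective t x ψx (y , fxy) =
  (proj₁ (surjective y) , realized-intro ψY f single-valued ψx (proj₂ (surjective y)) fxy) ,
  λ t' realized-t' → Realized.sound realized-t' x ψx

names-ι : ∀ (p q : Cantor) {t : Tω} → (∀ n → t n ≡ ι (q n)) → δTω p t → δTω p (λ n → ι (q n))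
names-ι p q t≡ι names i = subst (δ𝕋 (λ j → p (pair i j))) (t≡ι i) (names i)

computable⇒T-computable : ∀ mode {X Y} (δX : Cantor → X → Set) (δY : Cantor → Y → Set) →
  IsRepresentation δX → IsRepresentation δY → (f : X → Y → Set) →
  Computable mode δX δY f → TComputable mode (asTRep δX) (asTRep δY) f
computable⇒T-computable mode δX δY rX rY f (M , admM , realizesM) =
  Realized ψX ψY f ,
  (machine ,
   compose-admissible mode (compose decodeMachine M) encodeMachine
     (compose-admissible mode decodeMachine M (decode-admissible mode) admM) (encode-admissible mode) ,
   computes) ,
  realized-realizer ψX ψY f (asTRep-single-valued rX) (asTRep-surjective rY)
  where
    ψX = asTRep δX
    ψY = asTRep δY
    machine = compose (compose decodeMachine M) encodeMachine
    computes : ∀ p t → δTω p t → Σ Tω (Realized ψX ψY f t) →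
      Σ Cantor λ q → Outputs machine p q × Σ Tω (λ t' → δTω q t' × Realized ψX ψY f t t')
    computes p t names (_ , realized (x , ψx@(p₁ , t≡ι , δp₁) , fx) _) =
      let q₁ , outM , y , δq₁ , fxy = realizesM p₁ x δp₁ fx
      in toName q₁ ,
         compose-outputs (compose decodeMachine M) encodeMachine p q₁ (toName q₁)
           (compose-outputs decodeMachine M p p₁ q₁ (decode-outputs p p₁ (names-ι p p₁ t≡ι names)) outM)
           (encode-outputs q₁) ,
         (λ n → ι (q₁ n)) , toName-names q₁ ,
         realized-intro ψY f (asTRep-single-valued rX) ψx (q₁ , (λ n → refl) , δq₁) fxy

T-computable⇒computable : ∀ mode {X Y} (δX : Cantor → X → Set) (δY : Cantor → Y → Set) (f : X → Y → Set) →
  TComputable mode (asTRep δX) (asTRep δY) f → Computable mode δX δY f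
T-computable⇒computable mode δX δY f (F , (M , admM , computesF) , realizer) =
  machine ,
  compose-admissible mode (compose encodeMachine M) decodeMachine
    (compose-admissible mode encodeMachine M (encode-admissible mode) admM) (decode-admissible mode) ,
  computes
  where
    machine = compose (compose encodeMachine M) decodeMachine
    computes : ∀ p x → δX p x → Σ _ (f x) →
      Σ Cantor λ q → Outputs machine p q × Σ _ (λ y → δY q y × f x y)
    computes p x δp fx =
      let (t , Ft) , sound                = realizer (λ n → ι (p n)) x (p , (λ n → refl) , δp) fx
          qM , outM , t' , names , Ft'    = computesF (toName p) (λ n → ι (p n)) (toName-names p) (t , Ft)
          y , (q , t'≡ι , δq) , fxy       = sound t' Ft'
      in q ,
         compose-outputs (compose encodeMachine M) decodeMachine p qM q
           (compose-outputs encodeMachine M p (toName p) qM (encode-outputs p) outM)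
           (decode-outputs qM q (names-ι qM q t'≡ι names)) ,
         y , δq , fxy

T-computable⇒induced-computable : ∀ mode {X Y} (ψX : Tω → X → Set) (ψY : Tω → Y → Set) (f : X → Y → Set) →
  TComputable mode ψX ψY f → Computable mode (induced ψX) (induced ψY) f
T-computable⇒induced-computable mode ψX ψY f (F , (M , admM , computesF) , realizer) = M , admM , computes
  where
    computes : ∀ p x → induced ψX p x → Σ _ (f x) →
      Σ Cantor λ q → Outputs M p q × Σ _ (λ y → induced ψY q y × f x y)
    computes p x (t , names , ψx) fx =
      let (t₀ , Ft₀) , sound              = realizer t x ψx fx
          q , outM , t' , names' , Ft'    = computesF p t names (t₀ , Ft₀)
          y , ψy , fxy                    = sound t' Ft'
      in q , outM , y , (t' , names' , ψy) , fxy

induced-computable⇒T-computable : ∀ mode {X Y} (ψX : Tω → X → Set) (ψY : Tω → Y → Set) →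
  IsTRepresentation ψX → IsTRepresentation ψY → (f : X → Y → Set) →
  Computable mode (induced ψX) (induced ψY) f → TComputable mode ψX ψY f
induced-computable⇒T-computable mode ψX ψY (single-valued , _) (_ , _ , surjective) f (M , admM , realizesM) =
  Realized ψX ψY f , (M , admM , computes) , realized-realizer ψX ψY f single-valued′ surjective
  where
    single-valued′ : SingleValued ψX
    single-valued′ {t} = single-valued t t _ _ (λ n → refl)
    computes : ∀ p t → δTω p t → Σ Tω (Realized ψX ψY f t) →
      Σ Cantor λ q → Outputs M p q × Σ Tω (λ t' → δTω q t' × Realized ψX ψY f t t')
    computes p t names (_ , realized (x , ψx , fx) _) =
      let q , outM , y , (t' , names' , ψy) , fxy = realizesM p x (t , names , ψx) fx
      in q , outM , t' , names' , realized-intro ψY f single-valued′ ψx ψy fxy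

proposition2 : (mode : Mode) →
    ((X Y : Set) (δX : Cantor → X → Set) (δY : Cantor → Y → Set) →
      IsRepresentation δX → IsRepresentation δY → (f : X → Y → Set) →
      Computable mode δX δY f ⇔ TComputable mode (asTRep δX) (asTRep δY) f)
    ×
    ((X Y : Set) (ψX : Tω → X → Set) (ψY : Tω → Y → Set) →
      IsTRepresentation ψX → IsTRepresentation ψY → (f : X → Y → Set) →
      TComputable mode ψX ψY f ⇔ Computable mode (induced ψX) (induced ψY) f)
proposition2 mode =
  (λ X Y δX δY rX rY f →
    mk⇔ (computable⇒T-computable mode δX δY rX rY f) (T-computable⇒computable mode δX δY f)) ,
  (λ X Y ψX ψY rX rY f →
    mk⇔ (T-computable⇒induced-computable mode ψX ψY f) (induced-computable⇒T-computable mode ψX ψY rX rY f))
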